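{- Let $(X,A,f,\alpha,r)$ be an entropy preserving reversible micro-macro dynamical system. Then $|I|=|D|$.
   Context: A reversible micro-macro dynamical system is a tuple $(X,A,f,\alpha,r)$ with $X,A$ finite sets, $f:X\to A$ surjective, $\alpha:X\to X$ a bijection, and $r:X\to X$ an involution ($r^2=\mathrm{id}$) with $r\alpha r=\alpha^{ -1}$. For $i\in X$, $|i|=|f^{ -1}(f(i))|$ and $S(i)=\ln|i|$. The system is entropy preserving if $S(r(i))=S(i)$ for all $i\in X$. $D=\{i:S(\alpha(i))<S(i)\}$, $I=\{i:S(\alpha(i))>S(i)\}$. -}

module Defs where

open import Data.Nat using (ℕ; _<_; _<?_)
open import Data.Fin using (Fin; _≟_)
open import Data.Fin.Properties using ()
open import Data.List using (List; length; filter; allFin)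
open import Data.Product using (Σ; _×_; ∃)
open import Function.Bundles using (_↔_; Inverse)
open import Relation.Binary.PropositionalEquality using (_≡_)
open import Relation.Unary using (Pred; Decidable)
open import Level using (0ℓ)

card : ∀ {n} (P : Pred (Fin n) 0ℓ) → Decidable P → ℕ
card {n} P P? = length (filter P? (allFin n))

Surj : ∀ {n m} → (Fin n → Fin m) → Set
Surj {n} {m} f = ∀ (a : Fin m) → ∃ λ (i : Fin n) → f i ≡ a

-- A reversible micro-macro dynamical system with X = Fin n, A = Fin m.
-- α is a bijection (given with its inverse), r an involution, r α r = α⁻¹.
record RMMDS (n m : ℕ) : Set where
  field
    f       : Fin n → Fin m
    f-surj  : Surj f
    α       : Fin n ↔ Fin n
    r       : Fin n → Fin n
    r-invol : ∀ i → r (r i) ≡ i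
    rαr     : ∀ i → r (Inverse.to α (r i)) ≡ Inverse.from α i

  αf : Fin n → Fin n
  αf = Inverse.to α

  size : Fin n → ℕ
  size i = card (λ j → f j ≡ f i) (λ j → f j ≟ f i)

  -- Since S(i) = ln |i| and ln is strictly increasing on positive naturals,
  -- S(a) < S(b) iff |a| < |b|, and S(a) = S(b) iff |a| = |b|.
  EntropyPreserving : Set
  EntropyPreserving = ∀ i → size (r i) ≡ size i

  -- D = {i : S(α i) < S(i)},  I = {i : S(α i) > S(i)}
  D : Pred (Fin n) 0ℓ
  D i = size (αf i) < size i

  D? : Decidable D
  D? i = size (αf i) <? size i

  I : Pred (Fin n) 0ℓ
  I i = size i < size (αf i)

  I? : Decidable I
  I? i = size i <? size (αf i)

  cardD cardI : ℕ
  cardD = card D D?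
  cardI = card I I?

{-# OPTIONS --safe #-}
-- The map rα = r ∘ α is an involution with α (rα i) = r i.  As r preserves
-- entropy, the entropy step i ↦ α i of rα i is the step of i run backwards,
-- so rα i ∈ I exactly when i ∈ D; a bijection exchanging I and D equates
-- their sizes.
module Submission where

open import Defs
open import Data.Bool.Base using (Bool; true; false; if_then_else_)
open import Data.Fin.Base using (Fin; zero; suc)
open import Data.Fin.Permutation using (Permutation; _⟨$⟩ʳ_)
open import Data.List.Base using (length; filter; tabulate)
open import Data.Nat.Base using (ℕ; _<_)
open import Data.Nat.Properties using (+-0-commutativeMonoid)
open import Function.Base using (_∘_; id)
open import Function.Bundles using (Inverse; _⇔_; mk⇔; mk↔ₛ′)
open import Level using (Level; 0ℓ)
open import Relation.Binary.PropositionalEquality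
  using (_≡_; refl; sym; trans; cong; subst₂; module ≡-Reasoning)
open import Relation.Nullary.Decidable using (does; does-⇔)
open import Relation.Unary using (Pred; Decidable)
open import Algebra.Properties.CommutativeMonoid.Sum +-0-commutativeMonoid
  using (sum; sum-permute; sum-cong-≗)

private
  variable
    a : Level
    A : Set a
    k m n : ℕ

bitToℕ : Bool → ℕ
bitToℕ b = if b then 1 else 0

indicator : {P : Pred A 0ℓ} → Decidable P → A → ℕ
indicator P? x = bitToℕ (does (P? x))

length-filter-tabulate : {P : Pred A 0ℓ} (P? : Decidable P) (g : Fin k → A) →
                         length (filter P? (tabulate g)) ≡ sum (indicator P? ∘ g)
length-filter-tabulate {k = ℕ.zero}  P? g = refl
length-filter-tabulate {k = ℕ.suc k} P? g with does (P? (g zero))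
... | true  = cong ℕ.suc (length-filter-tabulate P? (g ∘ suc))
... | false = length-filter-tabulate P? (g ∘ suc)

card≡sum-indicator : (P : Pred (Fin n) 0ℓ) (P? : Decidable P) → card P P? ≡ sum (indicator P?)
card≡sum-indicator P P? = length-filter-tabulate P? id

card-reindex : {P : Pred (Fin n) 0ℓ} {Q : Pred (Fin m) 0ℓ}
               (P? : Decidable P) (Q? : Decidable Q) (π : Permutation m n) →
               (∀ i → P (π ⟨$⟩ʳ i) ⇔ Q i) → card P P? ≡ card Q Q?
card-reindex {P = P} {Q} P? Q? π P∘π⇔Q = begin
  card P P?                           ≡⟨ card≡sum-indicator P P? ⟩
  sum (indicator P?)                  ≡⟨ sum-permute (indicator P?) π ⟩
  sum (indicator P? ∘ (π ⟨$⟩ʳ_))      ≡⟨ sum-cong-≗ (λ i → cong bitToℕ (does-⇔ (P∘π⇔Q i) (P? _) (Q? i))) ⟩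
  sum (indicator Q?)                  ≡⟨ card≡sum-indicator Q Q? ⟨
  card Q Q?                           ∎
  where open ≡-Reasoning

module _ (M : RMMDS n m) where
  open RMMDS M

  rα : Fin n → Fin n
  rα = r ∘ αf

  α∘rα≗r : ∀ i → αf (rα i) ≡ r i
  α∘rα≗r i = begin
    αf (r (αf i))                              ≡⟨ r-invol _ ⟨
    r (r (αf (r (αf i))))                      ≡⟨ cong r (rαr (αf i)) ⟩
    r (Inverse.from α (αf i))                  ≡⟨ cong r (Inverse.strictlyInverseʳ α i) ⟩
    r i                                        ∎
    where open ≡-Reasoning

  rα-involutive : ∀ i → rα (rα i) ≡ i
  rα-involutive i = trans (cong r (α∘rα≗r i)) (r-invol i)

  rα-permutation : Permutation n n
  rα-permutation = mk↔ₛ′ rα rα rα-involutive rα-involutive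

  I∘rα⇔D : EntropyPreserving → ∀ i → I (rα i) ⇔ D i
  I∘rα⇔D preserving i = mk⇔ (subst₂ _<_ before after) (subst₂ _<_ (sym before) (sym after))
    where
    before : size (rα i) ≡ size (αf i)
    before = preserving (αf i)

    after : size (αf (rα i)) ≡ size i
    after = trans (cong size (α∘rα≗r i)) (preserving i)

mainTheorem5 : ∀ {n m : ℕ} (M : RMMDS n m) → RMMDS.EntropyPreserving M → RMMDS.cardI M ≡ RMMDS.cardD M
mainTheorem5 M preserving =
  card-reindex (RMMDS.I? M) (RMMDS.D? M) (rα-permutation M) (I∘rα⇔D M preserving)
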